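{- Let $B$ be a nonempty subset of $M=\{\mathbf a\in\mathbb N^n:|\mathbf a|_1\le d\}$. Then $A=\textsc{Find-Cone-closed}(B,n)$ is cone-closed.
   Context: Exponent vectors $\mathbf a\in\mathbb N^n$ are identified with monomials $\mathbf x^{\mathbf a}$. A set $S\subseteq\mathbb N^n$ is cone-closed if $\mathbf f\in S$ and $\mathbf e\le\mathbf f$ coordinatewise imply $\mathbf e\in S$. The procedure $\textsc{Find-Cone-closed}(B,n)$, for a nonempty finite $B\subseteq\mathbb N^n$: if $n=1$, return $\{0,1,\dots,|B|-1\}$. Otherwise, let $\pi_n:\mathbb N^n\to\mathbb N^{n-1}$ be the projection onto the first $n-1$ coordinates, let $\ell$ be the maximum size of a preimage $\pi_n^{ -1}(\mathbf e)\cap B$ over $\mathbf e\in\pi_n(B)$, and for $i\in[\ell]$ let $F_i$ be the set of $\mathbf e\in\pi_n(B)$ with $|\pi_n^{ -1}(\mathbf e)\cap B|\ge i$; set $S_i=\textsc{Find-Cone-closed}(F_i,n-1)$ and return $A=\bigcup_{i=1}^{\ell}S_i\times\{i-1\}$. -}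

module Defs where

open import Data.Nat using (ℕ; zero; suc; _≤_; _≤?_; _⊔_; _∸_)
open import Data.List using (List; []; _∷_; map; length; filter; deduplicate; upTo; concatMap; foldr)
open import Data.List.Membership.Propositional using (_∈_)
open import Data.Vec using (Vec; []; _∷_; init; _∷ʳ_)
open import Data.Vec.Properties using (≡-dec)
open import Data.Vec.Relation.Binary.Pointwise.Inductive using (Pointwise)
import Data.Nat.Properties as ℕP
open import Relation.Binary.PropositionalEquality using (_≡_)
open import Relation.Nullary using (Dec)

-- Finite subsets of ℕ^k are represented by lists of vectors; a list
-- denotes the set of its elements (duplicates are ignored: the procedure
-- deduplicates before counting).

_≟V_ : ∀ {k} → (u v : Vec ℕ k) → Dec (u ≡ v)
_≟V_ = ≡-dec ℕP._≟_

dedup : ∀ {k} → List (Vec ℕ k) → List (Vec ℕ k)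
dedup = deduplicate _≟V_

card : ∀ {k} → List (Vec ℕ k) → ℕ
card B = length (dedup B)

proj : ∀ {k} → Vec ℕ (suc k) → Vec ℕ k
proj = init

fiberSize : ∀ {k} → List (Vec ℕ (suc k)) → Vec ℕ k → ℕ
fiberSize B e = length (filter (λ b → proj b ≟V e) (dedup B))

projSet : ∀ {k} → List (Vec ℕ (suc k)) → List (Vec ℕ k)
projSet B = dedup (map proj B)

maxFiber : ∀ {k} → List (Vec ℕ (suc k)) → ℕ
maxFiber B = foldr (λ e m → fiberSize B e ⊔ m) 0 (projSet B)

Fset : ∀ {k} → List (Vec ℕ (suc k)) → ℕ → List (Vec ℕ k)
Fset B i = filter (λ e → i ≤? fiberSize B e) (projSet B)

-- Find-Cone-closed(B, n) with n = suc m (vectors of length suc m).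
findConeClosed : (m : ℕ) → List (Vec ℕ (suc m)) → List (Vec ℕ (suc m))
findConeClosed zero    B = map (λ j → j ∷ []) (upTo (card B))
findConeClosed (suc m) B =
  concatMap (λ i → map (λ e → e ∷ʳ (i ∸ 1)) (findConeClosed m (Fset B i)))
            (map suc (upTo (maxFiber B)))

ConeClosed : ∀ {k} → List (Vec ℕ k) → Set
ConeClosed {k} S = ∀ (e f : Vec ℕ k) → f ∈ S → Pointwise _≤_ e f → e ∈ S

-- For n = 1 the output is an initial segment of ℕ.
-- For n > 1 two monotonicity facts do the work: F_j ⊆ F_i whenever i ≤ j,
-- and Find-Cone-closed is monotone in B (|B|, ℓ and every F_i are).
-- Hence S_j ⊆ S_i for i ≤ j.  If (e', s) ≤ (f', t) with f' ∈ S_{t+1},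
-- then e' ∈ S_{t+1} by induction, so e' ∈ S_{s+1}, i.e. (e', s) ∈ A.
module Submission where

open import Defs
open import Data.Nat using (ℕ; zero; suc; _≤_; _<_; _⊔_; _∸_; _≤?_; z≤n; s≤s)
open import Data.Nat.Properties using (≤-reflexive; ≤-trans; ≤-<-trans; m≤m⊔n; m≤n⊔m; ⊔-lub)
open import Data.List using (List; []; _∷_; _++_; map; length; foldr)
open import Data.List.Relation.Unary.All using (All)
import Data.List.Relation.Unary.All as All
open import Data.List.Relation.Unary.Any using (here; there)
open import Data.List.Relation.Unary.AllPairs using ([]; _∷_)
open import Data.List.Relation.Unary.Unique.Propositional using (Unique)
import Data.List.Relation.Unary.Unique.Propositional.Properties as Unique
open import Data.List.Relation.Unary.Unique.DecPropositional.Properties using (deduplicate-!)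
open import Data.List.Relation.Binary.Subset.Propositional using (_⊆_)
open import Data.List.Relation.Binary.Subset.Propositional.Properties using (⊆-refl; map⁺; filter⁺′)
open import Data.List.Membership.Propositional using (_∈_; find; lose)
open import Data.List.Membership.Propositional.Properties
  using (∈-map⁺; ∈-map⁻; ∈-upTo⁺; ∈-upTo⁻; ∈-concatMap⁺; ∈-concatMap⁻;
         ∈-deduplicate⁺; ∈-deduplicate⁻; ∈-∃++; ∈-++⁺ˡ; ∈-++⁺ʳ; ∈-++⁻)
import Data.List.Relation.Unary.Any.Properties as Any
open import Data.Vec using (Vec; sum; _∷ʳ_; initLast) renaming ([] to []ᵥ; _∷_ to _∷ᵥ_)
open import Data.Vec.Relation.Binary.Pointwise.Inductive using (Pointwise; []; _∷_)
open import Data.Product using (∃₂; _×_; _,_)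
open import Data.Sum using (inj₁; inj₂)
open import Data.Empty using (⊥-elim)
open import Function using (_∘_; id)
open import Relation.Binary.PropositionalEquality using (_≡_; _≢_; refl; cong; sym)

private
  variable
    A : Set
    k : ℕ

length-++-∷ : (us : List A) {x : A} {vs : List A} → length (us ++ x ∷ vs) ≡ suc (length (us ++ vs))
length-++-∷ []       = refl
length-++-∷ (_ ∷ us) = cong suc (length-++-∷ us)

unique⊆⇒length≤ : {xs ys : List A} → Unique xs → xs ⊆ ys → length xs ≤ length ys
unique⊆⇒length≤ [] _ = z≤n
unique⊆⇒length≤ {xs = x ∷ xs} (x∉xs ∷ xs!) x∷xs⊆ys
  with us , vs , refl ← ∈-∃++ (x∷xs⊆ys (here refl)) =
  ≤-trans (s≤s (unique⊆⇒length≤ xs! xs⊆us++vs)) (≤-reflexive (sym (length-++-∷ us)))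
  where
  xs⊆us++vs : xs ⊆ us ++ vs
  xs⊆us++vs {y} y∈xs with ∈-++⁻ us (x∷xs⊆ys (there y∈xs))
  ... | inj₁ y∈us         = ∈-++⁺ˡ y∈us
  ... | inj₂ (here refl)  = ⊥-elim (All.lookup x∉xs y∈xs refl)
  ... | inj₂ (there y∈vs) = ∈-++⁺ʳ us y∈vs

dedup⁺ : {xs ys : List (Vec ℕ k)} → xs ⊆ ys → dedup xs ⊆ dedup ys
dedup⁺ {xs = xs} xs⊆ys = ∈-deduplicate⁺ _≟V_ ∘ xs⊆ys ∘ ∈-deduplicate⁻ _≟V_ xs

card-mono : {B B′ : List (Vec ℕ k)} → B ⊆ B′ → card B ≤ card B′
card-mono {B = B} B⊆B′ = unique⊆⇒length≤ (deduplicate-! _≟V_ B) (dedup⁺ B⊆B′)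

fiberSize-mono : {B B′ : List (Vec ℕ (suc k))} → B ⊆ B′ → ∀ e → fiberSize B e ≤ fiberSize B′ e
fiberSize-mono {B = B} B⊆B′ e =
  unique⊆⇒length≤ (Unique.filter⁺ inFiber (deduplicate-! _≟V_ B))
                  (filter⁺′ inFiber inFiber id (dedup⁺ B⊆B′))
  where inFiber = λ b → proj b ≟V e

projSet-mono : {B B′ : List (Vec ℕ (suc k))} → B ⊆ B′ → projSet B ⊆ projSet B′
projSet-mono B⊆B′ = dedup⁺ (map⁺ proj B⊆B′)

Fset-mono : {B B′ : List (Vec ℕ (suc k))} → B ⊆ B′ → ∀ i → Fset B i ⊆ Fset B′ i
Fset-mono {B = B} {B′} B⊆B′ i =
  filter⁺′ (λ e → i ≤? fiberSize B e) (λ e → i ≤? fiberSize B′ e)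
           (λ {e} i≤ → ≤-trans i≤ (fiberSize-mono B⊆B′ e)) (projSet-mono B⊆B′)

Fset-antitone : (B : List (Vec ℕ (suc k))) {i j : ℕ} → i ≤ j → Fset B j ⊆ Fset B i
Fset-antitone B {i} {j} i≤j =
  filter⁺′ (λ e → j ≤? fiberSize B e) (λ e → i ≤? fiberSize B e) (≤-trans i≤j) (⊆-refl {x = projSet B})

-- maxFiber B is definitionally maxOf (fiberSize B) (projSet B).
maxOf : (A → ℕ) → List A → ℕ
maxOf f = foldr (λ x m → f x ⊔ m) 0

≤-maxOf : (f : A → ℕ) {x : A} {xs : List A} → x ∈ xs → f x ≤ maxOf f xs
≤-maxOf f (here refl)           = m≤m⊔n _ _
≤-maxOf f {xs = y ∷ _} (there p) = ≤-trans (≤-maxOf f p) (m≤n⊔m (f y) _)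

maxOf-mono : {f g : A → ℕ} {xs ys : List A} → (∀ x → f x ≤ g x) → xs ⊆ ys → maxOf f xs ≤ maxOf g ys
maxOf-mono {xs = []}     f≤g xs⊆ys = z≤n
maxOf-mono {g = g} {xs = x ∷ _} f≤g xs⊆ys =
  ⊔-lub (≤-trans (f≤g x) (≤-maxOf g (xs⊆ys (here refl)))) (maxOf-mono f≤g (xs⊆ys ∘ there))

maxFiber-mono : {B B′ : List (Vec ℕ (suc k))} → B ⊆ B′ → maxFiber B ≤ maxFiber B′
maxFiber-mono B⊆B′ = maxOf-mono (fiberSize-mono B⊆B′) (projSet-mono B⊆B′)

-- layer m B i is S_i × {i - 1}.
layer : (m : ℕ) → List (Vec ℕ (suc (suc m))) → ℕ → List (Vec ℕ (suc (suc m)))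
layer m B i = map (λ e → e ∷ʳ (i ∸ 1)) (findConeClosed m (Fset B i))

∈-findConeClosed⁻ : (m : ℕ) (B : List (Vec ℕ (suc (suc m)))) {x : Vec ℕ (suc (suc m))} →
                    x ∈ findConeClosed (suc m) B →
                    ∃₂ λ e t → x ≡ e ∷ʳ t × t < maxFiber B × e ∈ findConeClosed m (Fset B (suc t))
∈-findConeClosed⁻ m B x∈A
  with t , t∈ , x∈layer ← find (Any.map⁻ (∈-concatMap⁻ (layer m B) x∈A))
  with e , e∈S , refl ← ∈-map⁻ (_∷ʳ t) x∈layer
  = e , t , refl , ∈-upTo⁻ t∈ , e∈S

∈-findConeClosed⁺ : (m : ℕ) (B : List (Vec ℕ (suc (suc m)))) {e : Vec ℕ (suc m)} {t : ℕ} →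
                    t < maxFiber B → e ∈ findConeClosed m (Fset B (suc t)) →
                    e ∷ʳ t ∈ findConeClosed (suc m) B
∈-findConeClosed⁺ m B t<ℓ e∈S =
  ∈-concatMap⁺ (layer m B) (Any.map⁺ (lose (∈-upTo⁺ t<ℓ) (∈-map⁺ _ e∈S)))

findConeClosed-mono : (m : ℕ) {B B′ : List (Vec ℕ (suc m))} → B ⊆ B′ → findConeClosed m B ⊆ findConeClosed m B′
findConeClosed-mono zero B⊆B′ x∈A with j , j∈ , refl ← ∈-map⁻ _ x∈A =
  ∈-map⁺ _ (∈-upTo⁺ (≤-trans (∈-upTo⁻ j∈) (card-mono B⊆B′)))
findConeClosed-mono (suc m) {B} {B′} B⊆B′ x∈A with e , t , refl , t<ℓ , e∈S ← ∈-findConeClosed⁻ m B x∈A =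
  ∈-findConeClosed⁺ m B′ (≤-trans t<ℓ (maxFiber-mono B⊆B′))
                    (findConeClosed-mono m (Fset-mono B⊆B′ (suc t)) e∈S)

Pointwise-∷ʳ⁻ : {R : A → A → Set} (xs ys : Vec A k) {x y : A} →
                Pointwise R (xs ∷ʳ x) (ys ∷ʳ y) → Pointwise R xs ys × R x y
Pointwise-∷ʳ⁻ []ᵥ        []ᵥ        (r ∷ [])  = [] , r
Pointwise-∷ʳ⁻ (_ ∷ᵥ xs) (_ ∷ᵥ ys) (r ∷ rs) with rs′ , r′ ← Pointwise-∷ʳ⁻ xs ys rs = r ∷ rs′ , r′

findConeClosed-coneClosed : (m : ℕ) (B : List (Vec ℕ (suc m))) → ConeClosed (findConeClosed m B)
findConeClosed-coneClosed zero B (i ∷ᵥ []ᵥ) _ f∈A (i≤j ∷ []) with j , j∈ , refl ← ∈-map⁻ _ f∈A =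
  ∈-map⁺ _ (∈-upTo⁺ (≤-<-trans i≤j (∈-upTo⁻ j∈)))
findConeClosed-coneClosed (suc m) B x _ f∈A x≤f
  with f′ , t , refl , t<ℓ , f′∈S ← ∈-findConeClosed⁻ m B f∈A
  with e′ , s , refl ← initLast x
  with e′≤f′ , s≤t ← Pointwise-∷ʳ⁻ e′ f′ x≤f
  = ∈-findConeClosed⁺ m B (≤-<-trans s≤t t<ℓ)
      (findConeClosed-mono m (Fset-antitone B (s≤s s≤t))
        (findConeClosed-coneClosed m (Fset B (suc t)) e′ f′ f′∈S e′≤f′))

lemma26 : (m d : ℕ) (B : List (Vec ℕ (suc m))) → B ≢ [] → All (λ a → sum a ≤ d) B → ConeClosed (findConeClosed m B)
lemma26 m d B _ _ = findConeClosed-coneClosed m B
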